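{- Let $k\ge2$ be an integer, $p$ a prime, and $\mathbf{u},\mathbf{v}\in\mathbb{Z}_{p,1}^k$ equivalent tuples. If $\mathbf{u}$ is eventually $(k,p)$-proper, then so is $\mathbf{v}$.
   Context: For a real number $x$, $\lVert x\rVert$ denotes the distance from $x$ to the nearest integer. For positive integers $n\mid m$, $\pi_{m\to n}:\mathbb{Z}/m\mathbb{Z}\to\mathbb{Z}/n\mathbb{Z}$ is the natural projection (coordinatewise on tuples). For a prime $p$ and positive integer $l$, $\mathbb{Z}_{p,l}$ is the set of residues in $\mathbb{Z}/pl\mathbb{Z}$ not congruent to $0$ mod $p$; so $\mathbb{Z}_{p,1}$ is the set of nonzero residues mod $p$. A tuple $\mathbf{w}\in\mathbb{Z}_{p,l}^k$ is $(k,p,l)$-proper if (i) some index $i$ has $\gcd(l,w_1,\ldots,w_{i-1},w_{i+1},\ldots,w_k)>1$ (computed with integer representatives), or (ii) some $t\in\frac1{lp}\mathbb{Z}$ has $\lVert tw_i\rVert\ge\frac1{k+1}$ for all $i$; otherwise it is $(k,p,l)$-improper, and $I(k,p,l)$ is the set of improper tuples. A tuple $\mathbf{w}\in\mathbb{Z}_{p,1}^k$ is eventually $(k,p)$-proper if there exists a positive integer $l$ with $\mathbf{w}\notin\pi_{lp\to p}(I(k,p,l))$. Two tuples $\mathbf{u},\mathbf{v}\in\mathbb{Z}_{p,1}^k$ are equivalent if $\mathbf{v}$ can be obtained from $\mathbf{u}$ by a finite sequence of the operations: permuting the coordinates; replacing one coordinate $u_i$ by $-u_i$; multiplying the whole tuple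 by a unit $a\in(\mathbb{Z}/p\mathbb{Z})^\times$. -}

module Defs where

open import Data.Nat as ℕ using (ℕ; zero; suc; _*_; _<_; _∸_; _%_)
open import Data.Nat.Divisibility using (_∣_)
open import Data.Nat.GCD using (gcd)
open import Data.Integer as ℤ using (ℤ; +_)
open import Data.Rational as ℚ using (ℚ; 0ℚ; _⊓_; _≤_)
open import Data.Fin as Fin using (Fin)
open import Data.Fin.Permutation using (Permutation′; _⟨$⟩ʳ_)
open import Data.List using (List; foldr)
open import Data.List.Base using (allFin)
open import Data.Product using (Σ; ∃; _×_)
open import Data.Sum using (_⊎_)
open import Data.Bool using (if_then_else_)
open import Relation.Nullary.Decidable using (⌊_⌋)
open import Function using (_∘_)
open import Relation.Nullary using (¬_; yes; no)
open import Relation.Binary.PropositionalEquality using (_≡_)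
open import Relation.Binary.Construct.Closure.ReflexiveTransitive using (Star)

‖_‖ : ℚ → ℚ
‖ x ‖ = (x ℚ.- (ℚ.floor x ℚ./ 1)) ⊓ ((ℚ.ceiling x ℚ./ 1) ℚ.- x)

-- total helpers (only ever used with a positive modulus)
_mod_ : ℕ → ℕ → ℕ
x mod zero = x
x mod suc n = x % suc n

-- the rational a / m  (only used with m > 0)
frac : ℤ → ℕ → ℚ
frac a zero = 0ℚ
frac a (suc m) = a ℚ./ suc m

-- Tuples are functions Fin k → ℕ; residues mod m are represented by
-- their canonical representatives in {0, …, m-1}.

InZ : (p l : ℕ) → {k : ℕ} → (Fin k → ℕ) → Set
InZ p l w = ∀ i → (w i < l * p) × ¬ (p ∣ w i)

gcdExcept : (l : ℕ) → {k : ℕ} → (Fin k → ℕ) → Fin k → ℕ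
gcdExcept l {k} w i = foldr step l (allFin k)
  where
  step : Fin k → ℕ → ℕ
  step j acc with j Fin.≟ i
  ... | yes _ = acc
  ... | no _  = gcd (w j) acc

Proper : (k p l : ℕ) → (Fin k → ℕ) → Set
Proper k p l w =
  (Σ (Fin k) λ i → 1 < gcdExcept l w i)
  ⊎ (Σ ℤ λ a → ∀ i → frac (+ 1) (suc k) ≤ ‖ frac a (l * p) ℚ.* (+ w i ℚ./ 1) ‖)

Improper : (k p l : ℕ) → (Fin k → ℕ) → Set
Improper k p l w = InZ p l w × ¬ Proper k p l w

InProjImproper : (k p l : ℕ) → (Fin k → ℕ) → Set
InProjImproper k p l w =
  Σ (Fin k → ℕ) λ w′ → Improper k p l w′ × (∀ i → w′ i mod p ≡ w i)

EventuallyProper : (k p : ℕ) → (Fin k → ℕ) → Set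
EventuallyProper k p w = Σ ℕ λ l → (0 ℕ.< l) × ¬ InProjImproper k p l w

data Step (p : ℕ) {k : ℕ} : (Fin k → ℕ) → (Fin k → ℕ) → Set where
  permute : ∀ u (σ : Permutation′ k) → Step p u (u ∘ (σ ⟨$⟩ʳ_))
  negate  : ∀ u (i : Fin k) → Step p u (λ j → if ⌊ j Fin.≟ i ⌋ then (p ∸ u j) mod p else u j)
  scale   : ∀ u (a : ℕ) → 0 ℕ.< a → a < p → Step p u (λ j → (a * u j) mod p)

Equivalent : (p : ℕ) → {k : ℕ} → (Fin k → ℕ) → (Fin k → ℕ) → Set
Equivalent p = Star (Step p)

{-# OPTIONS --safe #-}
module Submission where

-- Equivalence is generated by single steps, and a step u ↦ v preserves eventual properness
-- at the same level l: every improper lift w′ of v to ℤ/lpℤ pulls back to an improper lift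
-- w″ of u. For a permutation, w″ permutes w′; for negating coordinate i, w″ᵢ = lp − w′ᵢ;
-- for scaling by a, w″ = c w′ mod lp with c a ≡ 1 (mod p) and c coprime to l. In each
-- case a common divisor of l and the w″ⱼ divides the w′ⱼ, and ‖t w″ⱼ‖ = ‖t′ w′ⱼ‖ for all
-- j, with t′ = t resp. t′ = c t, because ‖·‖ is invariant under negation and integer
-- shifts. So properness of w″ would give properness of w′.

open import Defs
open import Data.Nat using (ℕ; zero; suc; NonZero)
open import Data.Integer as ℤ using (ℤ; +_; 1ℤ)
open import Relation.Binary.PropositionalEquality
  using (_≡_; _≢_; refl; sym; trans; cong; cong₂; subst; subst₂; module ≡-Reasoning)
import Data.Nat.Properties as ℕ
open import Data.Nat.DivMod
  using (m%n<n; [m+kn]%n≡m%n; %-distribˡ-+; %-distribˡ-*; %-remove-+ˡ; %-remove-+ʳ;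
         m∣n⇒o%n%m≡o%m; m<n⇒m%n≡m; n%n≡0; m%n%n≡m%n)
open import Data.Nat.Divisibility
open import Data.Nat.GCD using (gcd; gcd[m,n]∣m; gcd[m,n]∣n; gcd-greatest; module Bézout)
open import Data.Nat.Coprimality as Coprime using (Coprime; coprime-Bézout; coprime-divisor)
open import Data.Nat.Primality using (Prime; prime⇒irreducible; prime⇒nonZero; prime⇒nonTrivial; euclidsLemma)
open import Data.Nat.Induction using (<-wellFounded)
open import Induction.WellFounded using (Acc; acc)
import Data.Rational as ℚ
open import Data.Fin as Fin using (Fin)
open import Data.Fin.Permutation using (Permutation′; _⟨$⟩ʳ_; _⟨$⟩ˡ_; inverseˡ; inverseʳ)
open import Data.List using ([]; _∷_; foldr; allFin)
open import Data.List.Membership.Propositional using (_∈_)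
open import Data.List.Membership.Propositional.Properties using (∈-allFin)
open import Data.List.Relation.Unary.Any using (here; there)
open import Data.Product using (Σ; ∃; _×_; _,_; proj₁; proj₂)
open import Data.Sum using (_⊎_; inj₁; inj₂; [_,_])
open import Data.Bool using (if_then_else_)
open import Relation.Nullary using (¬_; yes; no; contradiction)
open import Relation.Nullary.Decidable using (⌊_⌋)
open import Relation.Binary.Construct.Closure.ReflexiveTransitive using (ε; _◅_)
open import Function using (_∘_; id)

module _ where
  open import Data.Integer.Tactic.RingSolver using (solve-∀)
  import Data.Integer.Properties as ℤ
  import Data.Integer.DivMod as ℤ
  import Data.Nat.Base as ℕ
  import Data.Nat.DivMod as ℕ
  open import Data.Rational using (ℚ; mkℚ; _/_; _+_; _*_; -_; _-_; _≤_; floor; ceiling; _⊓_; toℚᵘ)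
  import Data.Rational.Properties as ℚ
  open import Data.Rational.Unnormalised as ℚᵘ using (mkℚᵘ; *≡*; *≤*)
  import Data.Rational.Unnormalised.Properties as ℚᵘ
  open import Data.Rational.Solver using (module +-*-Solver)
  open +-*-Solver using (solve; _:+_; _:-_; :-_; _:=_)

  toℚᵘ-/ : ∀ i m → toℚᵘ (i / suc m) ℚᵘ.≃ mkℚᵘ i m
  toℚᵘ-/ i m = ℚ.toℚᵘ-fromℚᵘ (mkℚᵘ i m)

  [i+j]/n≡i/n+j/n : ∀ i j n .{{_ : NonZero n}} → (i ℤ.+ j) / n ≡ i / n + j / n
  [i+j]/n≡i/n+j/n i j (suc m) = ℚ.toℚᵘ-injective (begin
    toℚᵘ ((i ℤ.+ j) / suc m)                 ≈⟨ toℚᵘ-/ (i ℤ.+ j) m ⟩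
    mkℚᵘ (i ℤ.+ j) m                         ≈⟨ *≡* (common-denominator i j (+ suc m)) ⟩
    mkℚᵘ i m ℚᵘ.+ mkℚᵘ j m                   ≈⟨ ℚᵘ.+-cong (toℚᵘ-/ i m) (toℚᵘ-/ j m) ⟨
    toℚᵘ (i / suc m) ℚᵘ.+ toℚᵘ (j / suc m)   ≈⟨ ℚ.toℚᵘ-homo-+ (i / suc m) (j / suc m) ⟨
    toℚᵘ (i / suc m + j / suc m)             ∎)
    where
    open ℚᵘ.≃-Reasoning
    common-denominator : ∀ i j d → (i ℤ.+ j) ℤ.* (d ℤ.* d) ≡ (i ℤ.* d ℤ.+ j ℤ.* d) ℤ.* d
    common-denominator = solve-∀

  [-i]/n≡-[i/n] : ∀ i n .{{_ : NonZero n}} → (ℤ.- i) / n ≡ - (i / n)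
  [-i]/n≡-[i/n] i (suc m) = ℚ.toℚᵘ-injective (begin
    toℚᵘ ((ℤ.- i) / suc m)   ≈⟨ toℚᵘ-/ (ℤ.- i) m ⟩
    ℚᵘ.- mkℚᵘ i m            ≈⟨ ℚᵘ.-‿cong (toℚᵘ-/ i m) ⟨
    ℚᵘ.- toℚᵘ (i / suc m)    ≈⟨ ℚ.toℚᵘ-homo‿- (i / suc m) ⟨
    toℚᵘ (- (i / suc m))     ∎)
    where open ℚᵘ.≃-Reasoning

  [i/n]*[j/1]≡[i*j]/n : ∀ i j n .{{_ : NonZero n}} → (i / n) * (j / 1) ≡ (i ℤ.* j) / n
  [i/n]*[j/1]≡[i*j]/n i j (suc m) = ℚ.toℚᵘ-injective (begin
    toℚᵘ ((i / suc m) * (j / 1))          ≈⟨ ℚ.toℚᵘ-homo-* (i / suc m) (j / 1) ⟩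
    toℚᵘ (i / suc m) ℚᵘ.* toℚᵘ (j / 1)    ≈⟨ ℚᵘ.*-cong (toℚᵘ-/ i m) (toℚᵘ-/ j 0) ⟩
    mkℚᵘ i m ℚᵘ.* mkℚᵘ j 0                ≈⟨ *≡* (cong ((i ℤ.* j) ℤ.*_) (sym (ℤ.*-identityʳ (+ suc m)))) ⟩
    mkℚᵘ (i ℤ.* j) m                      ≈⟨ toℚᵘ-/ (i ℤ.* j) m ⟨
    toℚᵘ ((i ℤ.* j) / suc m)              ∎)
    where open ℚᵘ.≃-Reasoning

  [i*n]/n≡i/1 : ∀ i n .{{_ : NonZero n}} → (i ℤ.* + n) / n ≡ i / 1
  [i*n]/n≡i/1 i (suc m) = ℚ.toℚᵘ-injective (begin
    toℚᵘ ((i ℤ.* + suc m) / suc m)   ≈⟨ toℚᵘ-/ (i ℤ.* + suc m) m ⟩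
    mkℚᵘ (i ℤ.* + suc m) m           ≈⟨ *≡* (ℤ.*-identityʳ (i ℤ.* + suc m)) ⟩
    mkℚᵘ i 0                         ≈⟨ toℚᵘ-/ i 0 ⟨
    toℚᵘ (i / 1)                     ∎)
    where open ℚᵘ.≃-Reasoning

  floor-≤ : ∀ x → floor x / 1 ≤ x
  floor-≤ x@(mkℚ n m _) = ℚ.toℚᵘ-cancel-≤ (ℚᵘ.≤-respˡ-≃ (ℚᵘ.≃-sym (toℚᵘ-/ (floor x) 0))
    (*≤* (ℤ.≤-trans (ℤ.[n/d]*d≤n n (+ suc m)) (ℤ.≤-reflexive (sym (ℤ.*-identityʳ n))))))

  ≤⇒≤floor : ∀ {i x} → i / 1 ≤ x → i ℤ.≤ floor x
  ≤⇒≤floor {i} {x@(mkℚ n m _)} i≤x with ℚᵘ.≤-respˡ-≃ (toℚᵘ-/ i 0) (ℚ.toℚᵘ-mono-≤ i≤x)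
  ... | *≤* i*d≤n*1 = subst (i ℤ.≤_) (ℤ.pred-suc (floor x))
                        (ℤ.i<j⇒i≤pred[j] {j = ℤ.suc (floor x)} (ℤ.*-cancelʳ-<-nonNeg (+ suc m) i*d<[1+floor]*d))
    where
    open ℤ.≤-Reasoning
    i*d<[1+floor]*d : i ℤ.* + suc m ℤ.< ℤ.suc (floor x) ℤ.* + suc m
    i*d<[1+floor]*d = begin-strict
      i ℤ.* + suc m                     ≤⟨ i*d≤n*1 ⟩
      n ℤ.* 1ℤ                          ≡⟨ ℤ.*-identityʳ n ⟩
      n                                 <⟨ ℤ.n<s[n/ℕd]*d n (suc m) ⟩
      ℤ.suc (n ℤ./ℕ suc m) ℤ.* + suc m  ≡⟨ cong (λ q → ℤ.suc q ℤ.* + suc m) (ℤ.div-pos-is-/ℕ n (suc m)) ⟨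
      ℤ.suc (floor x) ℤ.* + suc m       ∎

  [x+k]-k≡x : ∀ x k → (x + k) - k ≡ x
  [x+k]-k≡x = solve 2 (λ x k → (x :+ k) :- k := x) refl

  [x+k]-[y+k]≡x-y : ∀ x y k → (x + k) - (y + k) ≡ x - y
  [x+k]-[y+k]≡x-y = solve 3 (λ x y k → (x :+ k) :- (y :+ k) := x :- y) refl

  neg-involutive : ∀ x → - - x ≡ x
  neg-involutive = solve 1 (λ x → :- :- x := x) refl

  -x-[-y]≡y-x : ∀ x y → - x - - y ≡ y - x
  -x-[-y]≡y-x = solve 2 (λ x y → :- x :- :- y := y :- x) refl

  [i-j]/1≡i/1-j/1 : ∀ i j → (i ℤ.- j) / 1 ≡ i / 1 - j / 1
  [i-j]/1≡i/1-j/1 i j = trans ([i+j]/n≡i/n+j/n i (ℤ.- j) 1) (cong (λ y → i / 1 + y) ([-i]/n≡-[i/n] j 1))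

  floor-+ : ∀ x k → floor (x + k / 1) ≡ floor x ℤ.+ k
  floor-+ x k = ℤ.≤-antisym ≤-shifted shifted-≤
    where
    i-j+j≡i : ∀ i j → i ℤ.- j ℤ.+ j ≡ i
    i-j+j≡i = solve-∀
    shifted-≤ : floor x ℤ.+ k ℤ.≤ floor (x + k / 1)
    shifted-≤ = ≤⇒≤floor (subst (_≤ x + k / 1) (sym ([i+j]/n≡i/n+j/n (floor x) k 1))
                                  (ℚ.+-monoˡ-≤ (k / 1) (floor-≤ x)))
    f : ℤ
    f = floor (x + k / 1)
    f-k≤floor : f ℤ.- k ℤ.≤ floor x
    f-k≤floor = ≤⇒≤floor (subst₂ _≤_ (sym ([i-j]/1≡i/1-j/1 f k)) ([x+k]-k≡x x (k / 1))
                                     (ℚ.+-monoˡ-≤ (- (k / 1)) (floor-≤ (x + k / 1))))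
    ≤-shifted : f ℤ.≤ floor x ℤ.+ k
    ≤-shifted = subst (ℤ._≤ floor x ℤ.+ k) (i-j+j≡i f k) (ℤ.+-monoˡ-≤ k f-k≤floor)

  ceiling≡-floor-neg : ∀ x → ceiling x ≡ ℤ.- floor (- x)
  ceiling≡-floor-neg record{} = refl

  ceiling-+ : ∀ x k → ceiling (x + k / 1) ≡ ceiling x ℤ.+ k
  ceiling-+ x k = begin
    ceiling (x + k / 1)              ≡⟨ ceiling≡-floor-neg (x + k / 1) ⟩
    ℤ.- floor (- (x + k / 1))        ≡⟨ cong (λ y → ℤ.- floor y) (ℚ.neg-distrib-+ x (k / 1)) ⟩
    ℤ.- floor (- x + - (k / 1))      ≡⟨ cong (λ y → ℤ.- floor (- x + y)) ([-i]/n≡-[i/n] k 1) ⟨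
    ℤ.- floor (- x + (ℤ.- k) / 1)    ≡⟨ cong ℤ.-_ (floor-+ (- x) (ℤ.- k)) ⟩
    ℤ.- (floor (- x) ℤ.+ ℤ.- k)      ≡⟨ neg-distrib (floor (- x)) k ⟩
    ℤ.- floor (- x) ℤ.+ k            ≡⟨ cong (ℤ._+ k) (ceiling≡-floor-neg x) ⟨
    ceiling x ℤ.+ k                  ∎
    where
    open ≡-Reasoning
    neg-distrib : ∀ i j → ℤ.- (i ℤ.+ ℤ.- j) ≡ ℤ.- i ℤ.+ j
    neg-distrib = solve-∀

  ‖x+k‖≡‖x‖ : ∀ x k → ‖ x + k / 1 ‖ ≡ ‖ x ‖
  ‖x+k‖≡‖x‖ x k = cong₂ _⊓_ below above
    where
    open ≡-Reasoning
    below : (x + k / 1) - floor (x + k / 1) / 1 ≡ x - floor x / 1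
    below = begin
      (x + k / 1) - floor (x + k / 1) / 1        ≡⟨ cong (λ i → (x + k / 1) - i / 1) (floor-+ x k) ⟩
      (x + k / 1) - (floor x ℤ.+ k) / 1          ≡⟨ cong (λ y → (x + k / 1) - y) ([i+j]/n≡i/n+j/n (floor x) k 1) ⟩
      (x + k / 1) - (floor x / 1 + k / 1)        ≡⟨ [x+k]-[y+k]≡x-y x (floor x / 1) (k / 1) ⟩
      x - floor x / 1                            ∎
    above : ceiling (x + k / 1) / 1 - (x + k / 1) ≡ ceiling x / 1 - x
    above = begin
      ceiling (x + k / 1) / 1 - (x + k / 1)      ≡⟨ cong (λ i → i / 1 - (x + k / 1)) (ceiling-+ x k) ⟩
      (ceiling x ℤ.+ k) / 1 - (x + k / 1)        ≡⟨ cong (λ y → y - (x + k / 1)) ([i+j]/n≡i/n+j/n (ceiling x) k 1) ⟩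
      (ceiling x / 1 + k / 1) - (x + k / 1)      ≡⟨ [x+k]-[y+k]≡x-y (ceiling x / 1) x (k / 1) ⟩
      ceiling x / 1 - x                          ∎

  ‖-x‖≡‖x‖ : ∀ x → ‖ - x ‖ ≡ ‖ x ‖
  ‖-x‖≡‖x‖ x = trans (cong₂ _⊓_ below above) (ℚ.⊓-comm (ceiling x / 1 - x) (x - floor x / 1))
    where
    open ≡-Reasoning
    below : - x - floor (- x) / 1 ≡ ceiling x / 1 - x
    below = begin
      - x - floor (- x) / 1                      ≡⟨ cong (λ i → - x - i / 1) (ℤ.neg-involutive (floor (- x))) ⟨
      - x - (ℤ.- ℤ.- floor (- x)) / 1            ≡⟨ cong (λ i → - x - (ℤ.- i) / 1) (ceiling≡-floor-neg x) ⟨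
      - x - (ℤ.- ceiling x) / 1                  ≡⟨ cong (λ y → - x - y) ([-i]/n≡-[i/n] (ceiling x) 1) ⟩
      - x - - (ceiling x / 1)                    ≡⟨ -x-[-y]≡y-x x (ceiling x / 1) ⟩
      ceiling x / 1 - x                          ∎
    above : ceiling (- x) / 1 - - x ≡ x - floor x / 1
    above = begin
      ceiling (- x) / 1 - - x                    ≡⟨ cong (λ i → i / 1 - - x) (ceiling≡-floor-neg (- x)) ⟩
      (ℤ.- floor (- - x)) / 1 - - x              ≡⟨ cong (λ y → (ℤ.- floor y) / 1 - - x) (neg-involutive x) ⟩
      (ℤ.- floor x) / 1 - - x                    ≡⟨ cong (λ y → y - - x) ([-i]/n≡-[i/n] (floor x) 1) ⟩
      - (floor x / 1) - - x                      ≡⟨ -x-[-y]≡y-x (floor x / 1) x ⟩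
      x - floor x / 1                            ∎

  ‖[i+k*n]/n‖≡‖i/n‖ : ∀ i k n .{{_ : NonZero n}} → ‖ (i ℤ.+ k ℤ.* + n) / n ‖ ≡ ‖ i / n ‖
  ‖[i+k*n]/n‖≡‖i/n‖ i k n = begin
    ‖ (i ℤ.+ k ℤ.* + n) / n ‖          ≡⟨ cong ‖_‖ ([i+j]/n≡i/n+j/n i (k ℤ.* + n) n) ⟩
    ‖ i / n + (k ℤ.* + n) / n ‖        ≡⟨ cong (λ y → ‖ i / n + y ‖) ([i*n]/n≡i/1 k n) ⟩
    ‖ i / n + k / 1 ‖                  ≡⟨ ‖x+k‖≡‖x‖ (i / n) k ⟩
    ‖ i / n ‖                          ∎
    where open ≡-Reasoning

  ‖[-i]/n‖≡‖i/n‖ : ∀ i n .{{_ : NonZero n}} → ‖ (ℤ.- i) / n ‖ ≡ ‖ i / n ‖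
  ‖[-i]/n‖≡‖i/n‖ i n = trans (cong ‖_‖ ([-i]/n≡-[i/n] i n)) (‖-x‖≡‖x‖ (i / n))

  ‖a/n*[n∸w]‖≡‖a/n*w‖ : ∀ a n .{{_ : NonZero n}} {w} → w ℕ.≤ n →
    ‖ frac a n * (+ (n ℕ.∸ w) / 1) ‖ ≡ ‖ frac a n * (+ w / 1) ‖
  ‖a/n*[n∸w]‖≡‖a/n*w‖ a n@(suc _) {w} w≤n = begin
    ‖ (a / n) * (+ (n ℕ.∸ w) / 1) ‖           ≡⟨ cong ‖_‖ ([i/n]*[j/1]≡[i*j]/n a (+ (n ℕ.∸ w)) n) ⟩
    ‖ (a ℤ.* + (n ℕ.∸ w)) / n ‖               ≡⟨ cong (λ i → ‖ i / n ‖) complement ⟩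
    ‖ (ℤ.- (a ℤ.* + w) ℤ.+ a ℤ.* + n) / n ‖   ≡⟨ ‖[i+k*n]/n‖≡‖i/n‖ (ℤ.- (a ℤ.* + w)) a n ⟩
    ‖ (ℤ.- (a ℤ.* + w)) / n ‖                 ≡⟨ ‖[-i]/n‖≡‖i/n‖ (a ℤ.* + w) n ⟩
    ‖ (a ℤ.* + w) / n ‖                       ≡⟨ cong ‖_‖ ([i/n]*[j/1]≡[i*j]/n a (+ w) n) ⟨
    ‖ (a / n) * (+ w / 1) ‖                   ∎
    where
    open ≡-Reasoning
    distrib : ∀ a m w → a ℤ.* (m ℤ.- w) ≡ ℤ.- (a ℤ.* w) ℤ.+ a ℤ.* m
    distrib = solve-∀
    complement : a ℤ.* + (n ℕ.∸ w) ≡ ℤ.- (a ℤ.* + w) ℤ.+ a ℤ.* + n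
    complement = begin
      a ℤ.* + (n ℕ.∸ w)        ≡⟨ cong (a ℤ.*_) (trans (ℤ.[+m]-[+n]≡m⊖n n w) (ℤ.⊖-≥ w≤n)) ⟨
      a ℤ.* (+ n ℤ.- + w)      ≡⟨ distrib a (+ n) (+ w) ⟩
      ℤ.- (a ℤ.* + w) ℤ.+ a ℤ.* + n ∎

  ‖a/n*[c*w%n]‖≡‖ac/n*w‖ : ∀ a c w n .{{_ : NonZero n}} →
    ‖ frac a n * (+ (c ℕ.* w ℕ.% n) / 1) ‖ ≡ ‖ frac (a ℤ.* + c) n * (+ w / 1) ‖
  ‖a/n*[c*w%n]‖≡‖ac/n*w‖ a c w n@(suc _) = begin
    ‖ (a / n) * (+ r / 1) ‖                   ≡⟨ cong ‖_‖ ([i/n]*[j/1]≡[i*j]/n a (+ r) n) ⟩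
    ‖ (a ℤ.* + r) / n ‖                       ≡⟨ ‖[i+k*n]/n‖≡‖i/n‖ (a ℤ.* + r) (a ℤ.* + q) n ⟨
    ‖ (a ℤ.* + r ℤ.+ (a ℤ.* + q) ℤ.* + n) / n ‖ ≡⟨ cong (λ i → ‖ i / n ‖) rescale ⟩
    ‖ (a ℤ.* + c ℤ.* + w) / n ‖               ≡⟨ cong ‖_‖ ([i/n]*[j/1]≡[i*j]/n (a ℤ.* + c) (+ w) n) ⟨
    ‖ ((a ℤ.* + c) / n) * (+ w / 1) ‖         ∎
    where
    open ≡-Reasoning
    r q : ℕ
    r = c ℕ.* w ℕ.% n
    q = c ℕ.* w ℕ./ n
    division : + c ℤ.* + w ≡ + r ℤ.+ + q ℤ.* + n
    division = begin
      + c ℤ.* + w          ≡⟨ ℤ.pos-* c w ⟨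
      + (c ℕ.* w)          ≡⟨ cong +_ (ℕ.m≡m%n+[m/n]*n (c ℕ.* w) n) ⟩
      + (r ℕ.+ q ℕ.* n)    ≡⟨ ℤ.pos-+ r (q ℕ.* n) ⟩
      + r ℤ.+ + (q ℕ.* n)  ≡⟨ cong (λ i → + r ℤ.+ i) (ℤ.pos-* q n) ⟩
      + r ℤ.+ + q ℤ.* + n  ∎
    regroup : ∀ a r q n → a ℤ.* r ℤ.+ (a ℤ.* q) ℤ.* n ≡ a ℤ.* (r ℤ.+ q ℤ.* n)
    regroup = solve-∀
    rescale : a ℤ.* + r ℤ.+ (a ℤ.* + q) ℤ.* + n ≡ a ℤ.* + c ℤ.* + w
    rescale = begin
      a ℤ.* + r ℤ.+ (a ℤ.* + q) ℤ.* + n     ≡⟨ regroup a (+ r) (+ q) (+ n) ⟩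
      a ℤ.* (+ r ℤ.+ + q ℤ.* + n)           ≡⟨ cong (a ℤ.*_) division ⟨
      a ℤ.* (+ c ℤ.* + w)                   ≡⟨ ℤ.*-assoc a (+ c) (+ w) ⟨
      a ℤ.* + c ℤ.* + w                     ∎

-- ℕ arithmetic is opened only here: its operators clash with those of ℚ in the block above.
open import Data.Nat as ℕ using (_*_; _+_; _∸_; _%_; _<_; _≤_)
open import Data.Nat.Tactic.RingSolver using (solve)

module _ {k} (l : ℕ) (w : Fin k → ℕ) (i : Fin k) where

  private
    -- The step function of gcdExcept is a where-bound helper of Defs and cannot be named:
    -- it is recovered by unification and then used only through step-skipsIndex.
    gcdExcept-as-foldr : Σ (Fin k → ℕ → ℕ) λ step → gcdExcept l w i ≡ foldr step l (allFin k)
    gcdExcept-as-foldr = _ , refl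

    step : Fin k → ℕ → ℕ
    step = proj₁ gcdExcept-as-foldr

    step-skipsIndex : ∀ j n → (j ≡ i × step j n ≡ n) ⊎ (j ≢ i × step j n ≡ gcd (w j) n)
    step-skipsIndex j n with j Fin.≟ i
    ... | yes j≡i = inj₁ (j≡i , refl)
    ... | no j≢i = inj₂ (j≢i , refl)

    foldr-∣ˡ : ∀ js → foldr step l js ∣ l
    foldr-∣ˡ [] = ∣-refl
    foldr-∣ˡ (j ∷ js) with step-skipsIndex j (foldr step l js)
    ... | inj₁ (_ , eq) rewrite eq = foldr-∣ˡ js
    ... | inj₂ (_ , eq) rewrite eq = ∣-trans (gcd[m,n]∣n (w j) _) (foldr-∣ˡ js)

    foldr-∣ : ∀ js j → j ∈ js → j ≢ i → foldr step l js ∣ w j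
    foldr-∣ (j ∷ js) j′ j′∈ j′≢i with step-skipsIndex j (foldr step l js) | j′∈
    ... | inj₁ (j≡i , _)  | here refl   = contradiction j≡i j′≢i
    ... | inj₁ (_ , eq)   | there j′∈js rewrite eq = foldr-∣ js j′ j′∈js j′≢i
    ... | inj₂ (_ , eq)   | here refl   rewrite eq = gcd[m,n]∣m (w j) _
    ... | inj₂ (_ , eq)   | there j′∈js rewrite eq = ∣-trans (gcd[m,n]∣n (w j) _) (foldr-∣ js j′ j′∈js j′≢i)

    foldr-greatest : ∀ {d} → d ∣ l → (∀ j → j ≢ i → d ∣ w j) → ∀ js → d ∣ foldr step l js
    foldr-greatest d∣l _ [] = d∣l
    foldr-greatest d∣l d∣w (j ∷ js) with step-skipsIndex j (foldr step l js)
    ... | inj₁ (_ , eq) rewrite eq = foldr-greatest d∣l d∣w js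
    ... | inj₂ (j≢i , eq) rewrite eq = gcd-greatest (d∣w j j≢i) (foldr-greatest d∣l d∣w js)

  gcdExcept-∣ˡ : gcdExcept l w i ∣ l
  gcdExcept-∣ˡ = foldr-∣ˡ (allFin k)

  gcdExcept-∣ : ∀ j → j ≢ i → gcdExcept l w i ∣ w j
  gcdExcept-∣ j = foldr-∣ (allFin k) j (∈-allFin j)

  gcdExcept-greatest : ∀ {d} → d ∣ l → (∀ j → j ≢ i → d ∣ w j) → d ∣ gcdExcept l w i
  gcdExcept-greatest d∣l d∣w = foldr-greatest d∣l d∣w (allFin k)

nonZero-∣ : ∀ {m n} .{{_ : NonZero n}} → m ∣ n → NonZero m
nonZero-∣ {zero} {n} 0∣n = contradiction (0∣⇒≡0 0∣n) (ℕ.≢-nonZero⁻¹ n)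
nonZero-∣ {suc _} _ = _

1<gcdExcept-transfer : ∀ {k l} .{{_ : NonZero l}} {w w′ : Fin k → ℕ} {i i′ : Fin k} →
  (∀ {d} → d ∣ l → (∀ j → j ≢ i → d ∣ w j) → ∀ j → j ≢ i′ → d ∣ w′ j) →
  1 < gcdExcept l w i → 1 < gcdExcept l w′ i′
1<gcdExcept-transfer {l = l} {w} {w′} {i} {i′} transfer 1<g = ℕ.<-≤-trans 1<g (∣⇒≤ g∣g′)
  where
  g∣g′ : gcdExcept l w i ∣ gcdExcept l w′ i′
  g∣g′ = gcdExcept-greatest l w′ i′ (gcdExcept-∣ˡ l w i) (transfer (gcdExcept-∣ˡ l w i) (gcdExcept-∣ l w i))
  instance
    g′≢0 : NonZero (gcdExcept l w′ i′)
    g′≢0 = nonZero-∣ (gcdExcept-∣ˡ l w′ i′)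

Proper-transfer : ∀ {k p l} .{{_ : NonZero l}} {w w′ : Fin k → ℕ} →
  (∀ j {d} → d ∣ l → d ∣ w j → d ∣ w′ j) →
  (∀ a → ∃ λ a′ → ∀ j → ‖ frac a (l * p) ℚ.* (+ w j ℚ./ 1) ‖ ≡ ‖ frac a′ (l * p) ℚ.* (+ w′ j ℚ./ 1) ‖) →
  Proper k p l w → Proper k p l w′
Proper-transfer ∣w′ _ (inj₁ (i , 1<g)) =
  inj₁ (i , 1<gcdExcept-transfer (λ d∣l d∣w j j≢i → ∣w′ j d∣l (d∣w j j≢i)) 1<g)
Proper-transfer {k} _ same-‖‖ (inj₂ (a , far)) with same-‖‖ a
... | a′ , eq = inj₂ (a′ , λ j → subst (frac (+ 1) (suc k) ℚ.≤_) (eq j) (far j))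

Proper-permute : ∀ {k p l} .{{_ : NonZero l}} {w : Fin k → ℕ} (σ : Permutation′ k) →
  Proper k p l (w ∘ (σ ⟨$⟩ˡ_)) → Proper k p l w
Proper-permute {l = l} {w} σ (inj₁ (i , 1<g)) = inj₁ (σ ⟨$⟩ˡ i , 1<gcdExcept-transfer moved 1<g)
  where
  moved : ∀ {d} → d ∣ l → (∀ j → j ≢ i → d ∣ w (σ ⟨$⟩ˡ j)) → ∀ j → j ≢ σ ⟨$⟩ˡ i → d ∣ w j
  moved _ d∣w j j≢σi = subst (_ ∣_) (cong w (inverseˡ σ))
    (d∣w (σ ⟨$⟩ʳ j) λ σj≡i → j≢σi (trans (sym (inverseˡ σ)) (cong (σ ⟨$⟩ˡ_) σj≡i)))
Proper-permute {k} {p} {l} {w} σ (inj₂ (a , far)) = inj₂ (a , λ j → subst far-at (inverseˡ σ) (far (σ ⟨$⟩ʳ j)))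
  where
  far-at : Fin k → Set
  far-at j = frac (+ 1) (suc k) ℚ.≤ ‖ frac a (l * p) ℚ.* (+ w j ℚ./ 1) ‖

m*[n%d]%d≡m*n%d : ∀ m n d .{{_ : NonZero d}} → m * (n % d) % d ≡ m * n % d
m*[n%d]%d≡m*n%d m n d = begin
  m * (n % d) % d              ≡⟨ %-distribˡ-* m (n % d) d ⟩
  (m % d) * (n % d % d) % d    ≡⟨ cong (λ x → (m % d) * x % d) (m%n%n≡m%n n d) ⟩
  (m % d) * (n % d) % d        ≡⟨ %-distribˡ-* m n d ⟨
  m * n % d                    ∎
  where open ≡-Reasoning

[m%d]*n%d≡m*n%d : ∀ m n d .{{_ : NonZero d}} → (m % d) * n % d ≡ m * n % d
[m%d]*n%d≡m*n%d m n d = begin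
  (m % d) * n % d   ≡⟨ cong (_% d) (ℕ.*-comm (m % d) n) ⟩
  n * (m % d) % d   ≡⟨ m*[n%d]%d≡m*n%d n m d ⟩
  n * m % d         ≡⟨ cong (_% d) (ℕ.*-comm n m) ⟩
  m * n % d         ∎
  where open ≡-Reasoning

∣m∣m∸n⇒∣n : ∀ {d m n} → n ≤ m → d ∣ m → d ∣ m ∸ n → d ∣ n
∣m∣m∸n⇒∣n n≤m d∣m d∣m∸n = ∣m+n∣m⇒∣n (subst (_ ∣_) (sym (ℕ.m∸n+n≡m n≤m)) d∣m) d∣m∸n

coprime-* : ∀ {c m n} → Coprime c m → Coprime c n → Coprime c (m * n)
coprime-* {c} {m} {n} c⊥m c⊥n {d} (d∣c , d∣m*n) =
  c⊥m (d∣c , coprime-divisor d⊥n (subst (d ∣_) (ℕ.*-comm m n) d∣m*n))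
  where
  d⊥n : Coprime d n
  d⊥n (e∣d , e∣n) = c⊥n (∣-trans e∣d d∣c , e∣n)

prime∤⇒coprime : ∀ {p n} → Prime p → ¬ p ∣ n → Coprime p n
prime∤⇒coprime pp p∤n {d} (d∣p , d∣n) with prime⇒irreducible pp d∣p
... | inj₁ d≡1 = d≡1
... | inj₂ refl = contradiction d∣n p∤n

%≡1%⇒coprime : ∀ {c n} .{{_ : NonZero n}} → c % n ≡ 1 % n → Coprime c n
%≡1%⇒coprime {c} {n} c%n≡1 {d} (d∣c , d∣n) =
  ∣1⇒≡1 (∣n∣m%n⇒∣m d∣n (subst (d ∣_) c%n≡1 (%-presˡ-∣ d∣c d∣n)))

inverse-mod : ∀ {a n} .{{_ : NonZero n}} → Coprime a n → ∃ λ b → b * a % n ≡ 1 % n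
inverse-mod {a} {n@(suc n′)} a⊥n with coprime-Bézout a⊥n
... | Bézout.+- x y 1+yn≡xa = x , (begin
  x * a % n                    ≡⟨ cong (_% n) 1+yn≡xa ⟨
  (1 + y * n) % n              ≡⟨ [m+kn]%n≡m%n 1 y n ⟩
  1 % n                        ∎)
  where open ≡-Reasoning
... | Bézout.-+ x y 1+xa≡yn = n′ * x , (begin
  n′ * x * a % n               ≡⟨ [m+kn]%n≡m%n (n′ * x * a) 1 n ⟨
  (n′ * x * a + 1 * n) % n     ≡⟨ cong (_% n) n′xa+n≡1+n′yn ⟩
  (1 + n′ * y * n) % n         ≡⟨ [m+kn]%n≡m%n 1 (n′ * y) n ⟩
  1 % n                        ∎)
  where
  open ≡-Reasoning
  -- Here x a ≡ −1 (mod n), so (n − 1) x inverts a.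
  n′xa+n≡1+n′yn : n′ * x * a + 1 * n ≡ 1 + n′ * y * n
  n′xa+n≡1+n′yn = begin
    n′ * x * a + 1 * suc n′    ≡⟨ solve (n′ ∷ x ∷ a ∷ []) ⟩
    n′ * (1 + x * a) + 1       ≡⟨ cong (λ m → n′ * m + 1) 1+xa≡yn ⟩
    n′ * (y * suc n′) + 1      ≡⟨ solve (n′ ∷ y ∷ []) ⟩
    1 + n′ * y * suc n′        ∎

-- c = b s l + r p with s l ≡ 1 (mod p) and r p ≡ 1 (mod l), so c ≡ b (mod p) and c ≡ 1 (mod l).
crt-coprimeTo : ∀ {p l} .{{_ : NonZero p}} .{{_ : NonZero l}} → Coprime p l → ∀ b →
  ∃ λ c → c % p ≡ b % p × Coprime c l
crt-coprimeTo {p} {l} p⊥l b with inverse-mod (Coprime.sym p⊥l) | inverse-mod p⊥l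
... | s , sl≡1 | r , rp≡1 = b * (s * l) + r * p , c≡b , %≡1%⇒coprime c≡1
  where
  open ≡-Reasoning
  c≡b : (b * (s * l) + r * p) % p ≡ b % p
  c≡b = begin
    (b * (s * l) + r * p) % p   ≡⟨ [m+kn]%n≡m%n (b * (s * l)) r p ⟩
    b * (s * l) % p             ≡⟨ m*[n%d]%d≡m*n%d b (s * l) p ⟨
    b * (s * l % p) % p         ≡⟨ cong (λ x → b * x % p) sl≡1 ⟩
    b * (1 % p) % p             ≡⟨ m*[n%d]%d≡m*n%d b 1 p ⟩
    b * 1 % p                   ≡⟨ cong (_% p) (ℕ.*-identityʳ b) ⟩
    b % p                       ∎
  c≡1 : (b * (s * l) + r * p) % l ≡ 1 % l
  c≡1 = trans (%-remove-+ˡ (r * p) (∣n⇒∣m*n b (n∣m*n s))) rp≡1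

-- Factors p of l are stripped first: if l = q p, a c that works for q also works for l, as p ∤ c.
∃-≡-mod-coprimeTo : ∀ {p b} .{{_ : NonZero p}} → Prime p → ¬ p ∣ b → ∀ l .{{_ : NonZero l}} →
  ∃ λ c → c % p ≡ b % p × Coprime c l
∃-≡-mod-coprimeTo {p} {b} pp p∤b l = go l (<-wellFounded l)
  where
  1<p : 1 < p
  1<p = ℕ.nonTrivial⇒n>1 p {{prime⇒nonTrivial pp}}
  c⊥p : ∀ {c} → c % p ≡ b % p → Coprime c p
  c⊥p {c} c≡b = Coprime.sym (prime∤⇒coprime pp λ p∣c →
    p∤b (m%n≡0⇒n∣m b p (trans (sym c≡b) (n∣m⇒m%n≡0 c p p∣c))))
  go : ∀ l .{{_ : NonZero l}} → Acc _<_ l → ∃ λ c → c % p ≡ b % p × Coprime c l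
  go l (acc smaller) with p ∣? l
  ... | no p∤l = crt-coprimeTo (prime∤⇒coprime pp p∤l) b
  ... | yes (divides q refl) with go q {{ℕ.m*n≢0⇒m≢0 q}} (smaller (ℕ.m<m*n q p {{ℕ.m*n≢0⇒m≢0 q}} 1<p))
  ...   | c , c≡b , c⊥q = c , c≡b , coprime-* c⊥q (c⊥p c≡b)

inverse⇒∤ : ∀ {p a b} .{{_ : NonZero p}} → Prime p → b * a % p ≡ 1 % p → ¬ p ∣ b
inverse⇒∤ {p} {a} {b} pp ba≡1 p∣b = ℕ.nonTrivial⇒≢1 {{prime⇒nonTrivial pp}}
  (∣1⇒≡1 (m%n≡0⇒n∣m 1 p (trans (sym ba≡1) (n∣m⇒m%n≡0 (b * a) p (∣m⇒∣m*n a p∣b)))))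

∃-inverse-coprimeTo : ∀ {p a} .{{_ : NonZero p}} → Prime p → Coprime a p → ∀ l .{{_ : NonZero l}} →
  ∃ λ c → c * a % p ≡ 1 % p × Coprime c l
∃-inverse-coprimeTo {p} {a} pp a⊥p l with inverse-mod a⊥p
... | b , ba≡1 with ∃-≡-mod-coprimeTo pp (inverse⇒∤ pp ba≡1) l
...   | c , c≡b , c⊥l = c , ca≡1 , c⊥l
  where
  open ≡-Reasoning
  ca≡1 : c * a % p ≡ 1 % p
  ca≡1 = begin
    c * a % p          ≡⟨ [m%d]*n%d≡m*n%d c a p ⟨
    (c % p) * a % p    ≡⟨ cong (λ x → x * a % p) c≡b ⟩
    (b % p) * a % p    ≡⟨ [m%d]*n%d≡m*n%d b a p ⟩
    b * a % p          ≡⟨ ba≡1 ⟩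
    1 % p              ∎

x%p≡[p∸y]%p⇒p∣x+y : ∀ {p x y} .{{_ : NonZero p}} → y ≤ p → x % p ≡ (p ∸ y) % p → p ∣ x + y
x%p≡[p∸y]%p⇒p∣x+y {p} {x} {y} y≤p x≡-y = m%n≡0⇒n∣m (x + y) p (begin
  (x + y) % p                    ≡⟨ %-distribˡ-+ x y p ⟩
  (x % p + y % p) % p            ≡⟨ cong (λ z → (z + y % p) % p) x≡-y ⟩
  ((p ∸ y) % p + y % p) % p      ≡⟨ %-distribˡ-+ (p ∸ y) y p ⟨
  (p ∸ y + y) % p                ≡⟨ cong (_% p) (ℕ.m∸n+n≡m y≤p) ⟩
  p % p                          ≡⟨ n%n≡0 p ⟩
  0                              ∎)
  where open ≡-Reasoning

[n∸x]%p≡y%p : ∀ {p n x y} .{{_ : NonZero p}} → p ∣ n → x ≤ n → p ∣ x + y → (n ∸ x) % p ≡ y % p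
[n∸x]%p≡y%p {p} {n} {x} {y} p∣n x≤n p∣x+y = begin
  (n ∸ x) % p              ≡⟨ %-remove-+ʳ (n ∸ x) p∣x+y ⟨
  (n ∸ x + (x + y)) % p    ≡⟨ cong (_% p) (ℕ.+-assoc (n ∸ x) x y) ⟨
  (n ∸ x + x + y) % p      ≡⟨ cong (λ z → (z + y) % p) (ℕ.m∸n+n≡m x≤n) ⟩
  (n + y) % p              ≡⟨ %-remove-+ˡ y p∣n ⟩
  y % p                    ∎
  where open ≡-Reasoning

n∸x<n∧p∤n∸x : ∀ {p n x} → p ∣ n → x < n → ¬ p ∣ x → n ∸ x < n × ¬ p ∣ n ∸ x
n∸x<n∧p∤n∸x {p} {n} {x} p∣n x<n p∤x =
  ℕ.∸-monoʳ-< 0<x (ℕ.<⇒≤ x<n) , p∤x ∘ ∣m∣m∸n⇒∣n (ℕ.<⇒≤ x<n) p∣n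
  where
  0<x : 0 < x
  0<x = ℕ.n≢0⇒n>0 λ x≡0 → p∤x (subst (p ∣_) (sym x≡0) (p ∣0))

c*x%n%p≡y%p : ∀ {p n a c x y} .{{_ : NonZero p}} .{{_ : NonZero n}} → p ∣ n →
  x % p ≡ a * y % p → c * a % p ≡ 1 % p → c * x % n % p ≡ y % p
c*x%n%p≡y%p {p} {n} {a} {c} {x} {y} p∣n x≡ay ca≡1 = begin
  c * x % n % p          ≡⟨ m∣n⇒o%n%m≡o%m p n (c * x) p∣n ⟩
  c * x % p              ≡⟨ m*[n%d]%d≡m*n%d c x p ⟨
  c * (x % p) % p        ≡⟨ cong (λ z → c * z % p) x≡ay ⟩
  c * (a * y % p) % p    ≡⟨ m*[n%d]%d≡m*n%d c (a * y) p ⟩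
  c * (a * y) % p        ≡⟨ cong (_% p) (ℕ.*-assoc c a y) ⟨
  c * a * y % p          ≡⟨ [m%d]*n%d≡m*n%d (c * a) y p ⟨
  (c * a % p) * y % p    ≡⟨ cong (λ z → z * y % p) ca≡1 ⟩
  (1 % p) * y % p        ≡⟨ [m%d]*n%d≡m*n%d 1 y p ⟩
  1 * y % p              ≡⟨ cong (_% p) (ℕ.*-identityˡ y) ⟩
  y % p                  ∎
  where open ≡-Reasoning

c*x%n<n∧p∤c*x%n : ∀ {p n c x} .{{_ : NonZero n}} → Prime p → p ∣ n → ¬ p ∣ c → ¬ p ∣ x →
  c * x % n < n × ¬ p ∣ c * x % n
c*x%n<n∧p∤c*x%n {p} {n} {c} {x} pp p∣n p∤c p∤x =
  m%n<n (c * x) n , λ p∣c*x%n → [ p∤c , p∤x ] (euclidsLemma c x pp (∣n∣m%n⇒∣m p∣n p∣c*x%n))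

permute-pullback : ∀ {k p l} .{{_ : NonZero l}} (u : Fin k → ℕ) (σ : Permutation′ k) →
  InProjImproper k p l (u ∘ (σ ⟨$⟩ʳ_)) → InProjImproper k p l u
permute-pullback u σ (w′ , (w′∈ , w′-improper) , w′≡v) =
  w′ ∘ (σ ⟨$⟩ˡ_) , (w′∈ ∘ (σ ⟨$⟩ˡ_) , w′-improper ∘ Proper-permute σ) ,
  λ j → trans (w′≡v (σ ⟨$⟩ˡ j)) (cong u (inverseʳ σ))

negate-pullback : ∀ {k p l} .{{_ : NonZero p}} .{{_ : NonZero l}} (u : Fin k → ℕ) (i : Fin k) → (∀ j → u j < p) →
  InProjImproper k p l (λ j → if ⌊ j Fin.≟ i ⌋ then (p ∸ u j) mod p else u j) → InProjImproper k p l u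
negate-pullback {k} {p@(suc _)} {l@(suc _)} u i u<p (w′ , (w′∈ , w′-improper) , w′≡v) =
  w″ , (w″∈ , w′-improper ∘ Proper-transfer {p = p} w″∣⇒w′∣ (λ a → a , same-‖‖ a)) , w″≡u
  where
  L : ℕ
  L = l * p
  p∣L : p ∣ L
  p∣L = n∣m*n l
  w′≤L : ∀ j → w′ j ≤ L
  w′≤L j = ℕ.<⇒≤ (proj₁ (w′∈ j))
  w″ : Fin k → ℕ
  w″ j = if ⌊ j Fin.≟ i ⌋ then L ∸ w′ j else w′ j
  w″∈ : InZ p l w″
  w″∈ j with j Fin.≟ i
  ... | yes _ = n∸x<n∧p∤n∸x p∣L (proj₁ (w′∈ j)) (proj₂ (w′∈ j))
  ... | no _ = w′∈ j
  w″≡u : ∀ j → w″ j mod p ≡ u j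
  w″≡u j with j Fin.≟ i | w′≡v j
  ... | yes _ | w′≡-u = trans ([n∸x]%p≡y%p p∣L (w′≤L j) p∣w′+u) (m<n⇒m%n≡m (u<p j))
    where
    p∣w′+u : p ∣ w′ j + u j
    p∣w′+u = x%p≡[p∸y]%p⇒p∣x+y (ℕ.<⇒≤ (u<p j)) w′≡-u
  ... | no _ | w′≡u = w′≡u
  w″∣⇒w′∣ : ∀ j {d} → d ∣ l → d ∣ w″ j → d ∣ w′ j
  w″∣⇒w′∣ j d∣l with j Fin.≟ i
  ... | yes _ = ∣m∣m∸n⇒∣n (w′≤L j) (∣m⇒∣m*n p d∣l)
  ... | no _ = λ d∣w′ → d∣w′
  same-‖‖ : ∀ a j → ‖ frac a L ℚ.* (+ w″ j ℚ./ 1) ‖ ≡ ‖ frac a L ℚ.* (+ w′ j ℚ./ 1) ‖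
  same-‖‖ a j with j Fin.≟ i
  ... | yes _ = ‖a/n*[n∸w]‖≡‖a/n*w‖ a L (w′≤L j)
  ... | no _ = refl

scale-pullback : ∀ {k p l} .{{_ : NonZero l}} → Prime p → (u : Fin k → ℕ) (a : ℕ) → 0 < a → a < p →
  (∀ j → u j < p) → InProjImproper k p l (λ j → (a * u j) mod p) → InProjImproper k p l u
scale-pullback {k} {p@(suc _)} {l@(suc _)} pp u a 0<a a<p u<p (w′ , (w′∈ , w′-improper) , w′≡v) =
  w″ , (w″∈ , w′-improper ∘ Proper-transfer {p = p} w″∣⇒w′∣ same-‖‖) , w″≡u
  where
  inverse : ∃ λ c → c * a % p ≡ 1 % p × Coprime c l
  inverse = ∃-inverse-coprimeTo pp (Coprime.sym (Coprime.prime⇒coprime pp {{ℕ.>-nonZero 0<a}} a<p)) l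
  c : ℕ
  c = proj₁ inverse
  ca≡1 : c * a % p ≡ 1 % p
  ca≡1 = proj₁ (proj₂ inverse)
  c⊥l : Coprime c l
  c⊥l = proj₂ (proj₂ inverse)
  L : ℕ
  L = l * p
  p∣L : p ∣ L
  p∣L = n∣m*n l
  w″ : Fin k → ℕ
  w″ j = c * w′ j % L
  w″∈ : InZ p l w″
  w″∈ j = c*x%n<n∧p∤c*x%n {c = c} pp p∣L (inverse⇒∤ {a = a} pp ca≡1) (proj₂ (w′∈ j))
  w″≡u : ∀ j → w″ j mod p ≡ u j
  w″≡u j = trans (c*x%n%p≡y%p {a = a} {c} p∣L (w′≡v j) ca≡1) (m<n⇒m%n≡m (u<p j))
  w″∣⇒w′∣ : ∀ j {d} → d ∣ l → d ∣ w″ j → d ∣ w′ j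
  w″∣⇒w′∣ j {d} d∣l d∣w″ = coprime-divisor d⊥c (∣n∣m%n⇒∣m (∣m⇒∣m*n p d∣l) d∣w″)
    where
    d⊥c : Coprime d c
    d⊥c (e∣d , e∣c) = c⊥l (e∣c , ∣-trans e∣d d∣l)
  same-‖‖ : ∀ t → ∃ λ t′ → ∀ j → ‖ frac t L ℚ.* (+ w″ j ℚ./ 1) ‖ ≡ ‖ frac t′ L ℚ.* (+ w′ j ℚ./ 1) ‖
  same-‖‖ t = t ℤ.* + c , λ j → ‖a/n*[c*w%n]‖≡‖ac/n*w‖ t c (w′ j) L

Step-pres-< : ∀ {k p} .{{_ : NonZero p}} {u v : Fin k → ℕ} → Step p u v → (∀ j → u j < p) → ∀ j → v j < p
Step-pres-< (permute u σ) u<p j = u<p (σ ⟨$⟩ʳ j)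
Step-pres-< {p = p@(suc _)} (negate u i) u<p j with j Fin.≟ i
... | yes _ = m%n<n (p ∸ u j) p
... | no _ = u<p j
Step-pres-< {p = p@(suc _)} (scale u a _ _) _ j = m%n<n (a * u j) p

Step-pullback : ∀ {k p l} .{{_ : NonZero l}} → Prime p → {u v : Fin k → ℕ} → Step p u v →
  (∀ j → u j < p) → InProjImproper k p l v → InProjImproper k p l u
Step-pullback _ (permute u σ) _ = permute-pullback u σ
Step-pullback pp (negate u i) u<p = negate-pullback {{prime⇒nonZero pp}} u i u<p
Step-pullback pp (scale u a 0<a a<p) u<p = scale-pullback pp u a 0<a a<p u<p

Equivalent-pullback : ∀ {k p l} .{{_ : NonZero l}} → Prime p → {u v : Fin k → ℕ} → Equivalent p u v →
  (∀ j → u j < p) → InProjImproper k p l v → InProjImproper k p l u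
Equivalent-pullback _ ε _ = id
Equivalent-pullback pp (step ◅ steps) u<p =
  Step-pullback pp step u<p ∘ Equivalent-pullback pp steps (Step-pres-< {{prime⇒nonZero pp}} step u<p)

proposition18 : (k : ℕ) → 2 ≤ k → (p : ℕ) → Prime p →
    (u v : Fin k → ℕ) → InZ p 1 u → InZ p 1 v → Equivalent p u v →
    EventuallyProper k p u → EventuallyProper k p v
proposition18 k _ p pp u v u∈ _ u~v (l , 0<l , u-proper) =
  l , 0<l , u-proper ∘ Equivalent-pullback {{ℕ.>-nonZero 0<l}} pp u~v u<p
  where
  u<p : ∀ j → u j < p
  u<p j = subst (u j <_) (ℕ.*-identityˡ p) (proj₁ (u∈ j))
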